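{- Let $G$ be a finite connected simple graph, and suppose that its complement $G^c$ contains an induced $4$-cycle. Then the lcm-lattice $L(I(G))$ of the edge ideal $I(G)$ is not pure.
   Context: For a finite simple graph $G$, the edge ideal is $I(G)=(x_ix_j:\ \{i,j\}\in E(G))$ in a polynomial ring over a field with variables indexed by $V(G)$; $G^c$ is the graph on $V(G)$ whose edges are the non-edges of $G$. For a monomial ideal $I$ with minimal monomial generating set $\{m_1,\dots,m_d\}$, the lcm-lattice $L(I)$ is the poset of all least common multiples of subsets of $\{m_1,\dots,m_d\}$ (the empty subset giving $1$), ordered by divisibility. A poset is pure if all its maximal chains have the same finite length. -}

module Defs where

open import Data.Nat using (ℕ; zero; suc; _⊔_; _≤_)
open import Data.Bool using (Bool; true; false; not; _∧_; _∨_; if_then_else_)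
open import Data.Fin using (Fin; _≟_)
open import Data.Vec using (Vec; zipWith; replicate; tabulate)
open import Data.Vec.Relation.Binary.Pointwise.Inductive using (Pointwise)
open import Data.List using (List; []; _∷_; foldr; map; length)
open import Data.List.Membership.Propositional using (_∈_)
open import Data.List.Relation.Unary.All using (All)
open import Data.Product using (Σ; ∃; _×_; _,_; proj₁; proj₂)
open import Relation.Binary.PropositionalEquality using (_≡_; _≢_)
open import Relation.Nullary using (¬_; does)

record SimpleGraph : Set where
  field
    n       : ℕ
    adj     : Fin n → Fin n → Bool
    symm    : ∀ i j → adj i j ≡ adj j i
    irrefl  : ∀ i → adj i i ≡ false
open SimpleGraph public

data Walk (G : SimpleGraph) : Fin (n G) → Fin (n G) → Set where
  [] : ∀ {u} → Walk G u u
  _∷_ : ∀ {u v w} → adj G u v ≡ true → Walk G v w → Walk G u w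

Connected : SimpleGraph → Set
Connected G = Fin (n G) × (∀ u v → Walk G u v)

complement : SimpleGraph → SimpleGraph
complement G = record
  { n = n G
  ; adj = λ i j → not (adj G i j) ∧ not (does (i ≟ j))
  ; symm = symm'
  ; irrefl = irr
  }
  where
    open import Relation.Binary.PropositionalEquality using (refl; cong₂; cong; sym)
    open import Relation.Nullary using (yes; no)
    eqsym : ∀ (i j : Fin (n G)) → does (i ≟ j) ≡ does (j ≟ i)
    eqsym i j with i ≟ j | j ≟ i
    ... | yes _ | yes _ = refl
    ... | no _  | no _  = refl
    ... | yes p | no q  = Data.Empty.⊥-elim (q (sym p))
      where import Data.Empty
    ... | no p  | yes q = Data.Empty.⊥-elim (p (sym q))
      where import Data.Empty
    symm' : ∀ i j → (not (adj G i j) ∧ not (does (i ≟ j))) ≡ (not (adj G j i) ∧ not (does (j ≟ i)))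
    symm' i j = cong₂ (λ a b → not a ∧ not b) (symm G i j) (eqsym i j)
    irr : ∀ i → (not (adj G i i) ∧ not (does (i ≟ i))) ≡ false
    irr i with i ≟ i
    ... | yes _ = Data.Bool.Properties.∧-zeroʳ (not (adj G i i))
      where import Data.Bool.Properties
    ... | no ¬p = Data.Empty.⊥-elim (¬p refl)
      where import Data.Empty

HasInducedC4 : SimpleGraph → Set
HasInducedC4 H = Σ (Fin (n H)) λ a → Σ (Fin (n H)) λ b → Σ (Fin (n H)) λ c → Σ (Fin (n H)) λ d →
  (a ≢ b) × (a ≢ c) × (a ≢ d) × (b ≢ c) × (b ≢ d) × (c ≢ d) ×
  (adj H a b ≡ true) × (adj H b c ≡ true) × (adj H c d ≡ true) × (adj H d a ≡ true) ×
  (adj H a c ≡ false) × (adj H b d ≡ false)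

-- Monomials in k[x_0,...,x_{n-1}] as exponent vectors

Monomial : ℕ → Set
Monomial m = Vec ℕ m

_∣ₘ_ : ∀ {m} → Monomial m → Monomial m → Set
u ∣ₘ v = Pointwise _≤_ u v

_∣ₘ<_ : ∀ {m} → Monomial m → Monomial m → Set
u ∣ₘ< v = (u ∣ₘ v) × (u ≢ v)

one : ∀ {m} → Monomial m
one = replicate _ 0

lcm : ∀ {m} → Monomial m → Monomial m → Monomial m
lcm = zipWith _⊔_

lcmList : ∀ {m} → List (Monomial m) → Monomial m
lcmList = foldr lcm one

Edge : SimpleGraph → Set
Edge G = Σ (Fin (n G)) λ i → Σ (Fin (n G)) λ j → adj G i j ≡ true

edgeMonomial : (G : SimpleGraph) → Edge G → Monomial (n G)
edgeMonomial G (i , j , _) =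
  tabulate (λ k → if does (k ≟ i) ∨ does (k ≟ j) then 1 else 0)

InLcmLattice : (G : SimpleGraph) → Monomial (n G) → Set
InLcmLattice G u = Σ (List (Edge G)) λ S → u ≡ lcmList (map (edgeMonomial G) S)

data Ascending {m} : List (Monomial m) → Set where
  []  : Ascending []
  [_] : ∀ u → Ascending (u ∷ [])
  _∷_ : ∀ {u v us} → u ∣ₘ< v → Ascending (v ∷ us) → Ascending (u ∷ v ∷ us)

IsChain : (G : SimpleGraph) → List (Monomial (n G)) → Set
IsChain G c = All (InLcmLattice G) c × Ascending c

IsMaximalChain : (G : SimpleGraph) → List (Monomial (n G)) → Set
IsMaximalChain G c = IsChain G c ×
  (∀ c' → IsChain G c' → (∀ {u} → u ∈ c → u ∈ c') → length c' ≤ length c)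

-- pure: all maximal chains have the same length
-- (length of a chain = number of elements - 1; comparing element counts is equivalent)
LcmLatticePure : SimpleGraph → Set
LcmLatticePure G = ∀ c c' → IsMaximalChain G c → IsMaximalChain G c' → length c ≡ length c'

-- Let x_a x_b x_c x_d be an induced 4-cycle of G^c, so ac and bd are edges of G while ab, bc, cd, da
-- are not. In L(I(G)) the only elements between x_a x_c and x_a x_b x_c x_d are these two: the support
-- of an lcm of edges is a union of edges, and no edge of G joins b or d to a or c. Elements of L(I(G))
-- are squarefree of degree 0 or at least 2, and connectivity lets every element of L(I(G)) other than 1
-- be extended, one new vertex at a time, up to the product of all N variables. This gives a maximal
-- chain 1 < x_a x_c < (degree 3) < ... < (degree N) with N elements, and a maximal chain
-- 1 < x_a x_c < x_a x_b x_c x_d < (degree 5) < ... < (degree N) with N - 1 elements; maximality in both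
-- cases holds because degrees strictly increase along a chain and avoid 1 (and also 3 in the second).
module Submission where

open import Data.Bool using (true; false; not; _∧_; _∨_; if_then_else_)
open import Data.Empty using (⊥-elim)
open import Data.Fin using (Fin; _≟_) renaming (zero to fzero; suc to fsuc)
open import Data.List using (List; []; _∷_; length; map)
open import Data.List.Membership.Propositional using (_∈_)
open import Data.List.Relation.Unary.All using (All; []; _∷_)
import Data.List.Relation.Unary.All as All
open import Data.List.Relation.Unary.Any using (here; there)
open import Data.Nat using (ℕ; zero; suc; _+_; _∸_; _⊔_; _≤_; _<_; z≤n; s≤s; pred)
open import Data.Nat.Properties hiding (_≟_)
open import Data.Product using (∃-syntax; _×_; _,_; proj₁; proj₂)
open import Data.Sum using (_⊎_; inj₁; inj₂)
import Data.Sum as Sum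
open import Data.Vec using ([]; _∷_; lookup; sum; replicate; tabulate)
open import Data.Vec.Properties using (lookup-zipWith; lookup-replicate; tabulate∘lookup; tabulate-cong; zipWith-assoc)
open import Data.Vec.Relation.Binary.Pointwise.Inductive using ([]; _∷_)
import Data.Vec.Relation.Binary.Pointwise.Inductive as Pointwise
open import Function using (_∘_)
open import Relation.Binary.PropositionalEquality
open import Relation.Nullary using (¬_; does; yes; no)
open import Relation.Nullary.Decidable using (dec-false)
open import Relation.Unary using (Decidable)
open import Defs

private variable
  m : ℕ
  u v w : Monomial m
  k y : Fin m

∣ₘ-refl : u ∣ₘ u
∣ₘ-refl = Pointwise.refl ≤-refl

∣ₘ-trans : u ∣ₘ v → v ∣ₘ w → u ∣ₘ w
∣ₘ-trans = Pointwise.trans ≤-trans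

∣ₘ-antisym : u ∣ₘ v → v ∣ₘ u → u ≡ v
∣ₘ-antisym []       []       = refl
∣ₘ-antisym (p ∷ ps) (q ∷ qs) = cong₂ _∷_ (≤-antisym p q) (∣ₘ-antisym ps qs)

lookup-≤⇒∣ₘ : (∀ k → lookup u k ≤ lookup v k) → u ∣ₘ v
lookup-≤⇒∣ₘ {u = []}    {[]}    _ = []
lookup-≤⇒∣ₘ {u = _ ∷ _} {_ ∷ _} f = f fzero ∷ lookup-≤⇒∣ₘ (f ∘ fsuc)

one-∣ₘ : one ∣ₘ u
one-∣ₘ {u = []}    = []
one-∣ₘ {u = _ ∷ _} = z≤n ∷ one-∣ₘ

∣ₘ-lcmˡ : (u v : Monomial m) → u ∣ₘ lcm u v
∣ₘ-lcmˡ []      []      = []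
∣ₘ-lcmˡ (x ∷ u) (y ∷ v) = m≤m⊔n x y ∷ ∣ₘ-lcmˡ u v

∣ₘ-lcmʳ : (u v : Monomial m) → v ∣ₘ lcm u v
∣ₘ-lcmʳ []      []      = []
∣ₘ-lcmʳ (x ∷ u) (y ∷ v) = m≤n⊔m x y ∷ ∣ₘ-lcmʳ u v

lcm-least : u ∣ₘ w → v ∣ₘ w → lcm u v ∣ₘ w
lcm-least []       []       = []
lcm-least (p ∷ ps) (q ∷ qs) = ⊔-lub p q ∷ lcm-least ps qs

lcm-monoʳ : (u : Monomial m) → v ∣ₘ w → lcm u v ∣ₘ lcm u w
lcm-monoʳ {w = w} u v∣w = lcm-least (∣ₘ-lcmˡ u w) (∣ₘ-trans v∣w (∣ₘ-lcmʳ u w))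

lcm-identityˡ : (u : Monomial m) → lcm one u ≡ u
lcm-identityˡ []      = refl
lcm-identityˡ (x ∷ u) = cong (x ∷_) (lcm-identityˡ u)

lcm-assoc : (u v w : Monomial m) → lcm (lcm u v) w ≡ lcm u (lcm v w)
lcm-assoc = zipWith-assoc ⊔-assoc

lcm-absorbs : u ∣ₘ v → lcm u v ≡ v
lcm-absorbs []       = refl
lcm-absorbs (p ∷ ps) = cong₂ _∷_ (m≤n⇒m⊔n≡n p) (lcm-absorbs ps)

lookup-lcm : (u v : Monomial m) (k : Fin m) → lookup (lcm u v) k ≡ lookup u k ⊔ lookup v k
lookup-lcm u v k = lookup-zipWith _⊔_ k u v

present-mono : u ∣ₘ v → 0 < lookup u k → 0 < lookup v k
present-mono {k = k} u∣v uk = ≤-trans uk (Pointwise.lookup u∣v k)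

degree : Monomial m → ℕ
degree = sum

degree-one : ∀ m → degree (one {m}) ≡ 0
degree-one zero    = refl
degree-one (suc m) = degree-one m

degree-ones : ∀ m → degree (replicate m 1) ≡ m
degree-ones zero    = refl
degree-ones (suc m) = cong suc (degree-ones m)

degree-mono : u ∣ₘ v → degree u ≤ degree v
degree-mono []       = z≤n
degree-mono (p ∷ ps) = +-mono-≤ p (degree-mono ps)

∣ₘ∧degree≡⇒≡ : u ∣ₘ v → degree u ≡ degree v → u ≡ v
∣ₘ∧degree≡⇒≡ [] _ = refl
∣ₘ∧degree≡⇒≡ {u = x ∷ u} (p ∷ ps) eq with m≤n⇒m<n∨m≡n p
... | inj₁ x<y  = ⊥-elim (<⇒≢ (+-mono-<-≤ x<y (degree-mono ps)) eq)
... | inj₂ refl = cong (x ∷_) (∣ₘ∧degree≡⇒≡ ps (+-cancelˡ-≡ x _ _ eq))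

degree-mono-< : u ∣ₘ< v → degree u < degree v
degree-mono-< (u∣v , u≢v) = ≤∧≢⇒< (degree-mono u∣v) (u≢v ∘ ∣ₘ∧degree≡⇒≡ u∣v)

∣ₘ∧degree<⇒∣ₘ< : u ∣ₘ v → degree u < degree v → u ∣ₘ< v
∣ₘ∧degree<⇒∣ₘ< u∣v lt = u∣v , λ { refl → <-irrefl refl lt }

degree<⇒absent : ∀ {m} {u : Monomial m} → degree u < m → ∃[ k ] lookup u k ≡ 0
degree<⇒absent {u = []}        ()
degree<⇒absent {u = zero  ∷ _} _        = fzero , refl
degree<⇒absent {u = suc x ∷ u} (s≤s lt) =
  let k , uk≡0 = degree<⇒absent {u = u} (≤-trans (s≤s (m≤n+m (degree u) x)) lt)
  in  fsuc k , uk≡0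

var : Fin m → Monomial m
var fzero    = 1 ∷ one
var (fsuc y) = 0 ∷ var y

lookup-var : (k y : Fin m) → lookup (var y) k ≡ (if does (k ≟ y) then 1 else 0)
lookup-var fzero    fzero    = refl
lookup-var fzero    (fsuc y) = refl
lookup-var (fsuc k) fzero    = lookup-replicate k 0
lookup-var (fsuc k) (fsuc y) = lookup-var k y

lookup-var-≢ : k ≢ y → lookup (var y) k ≡ 0
lookup-var-≢ {k = fzero}  {fzero}  k≢y = ⊥-elim (k≢y refl)
lookup-var-≢ {k = fzero}  {fsuc y} _   = refl
lookup-var-≢ {k = fsuc k} {fzero}  _   = lookup-replicate k 0
lookup-var-≢ {k = fsuc k} {fsuc y} k≢y = lookup-var-≢ (k≢y ∘ cong fsuc)

present⇒var-∣ₘ : 0 < lookup u y → var y ∣ₘ u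
present⇒var-∣ₘ {u = _ ∷ _} {fzero}  p = p ∷ one-∣ₘ
present⇒var-∣ₘ {u = _ ∷ _} {fsuc y} p = z≤n ∷ present⇒var-∣ₘ p

var-∣ₘ⇒present : var y ∣ₘ u → 0 < lookup u y
var-∣ₘ⇒present {y = fzero}  (p ∷ _)  = p
var-∣ₘ⇒present {y = fsuc y} (_ ∷ ps) = var-∣ₘ⇒present ps

lookup-lcm-var-≢ : k ≢ y → lookup (lcm (var y) u) k ≡ lookup u k
lookup-lcm-var-≢ {k = k} {y} {u} k≢y =
  trans (lookup-lcm (var y) u k) (cong (_⊔ lookup u k) (lookup-var-≢ k≢y))

support-lcm-var : 0 < lookup (lcm (var y) u) k → k ≡ y ⊎ 0 < lookup u k
support-lcm-var {y = y} {k = k} p with k ≟ y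
... | yes k≡y = inj₁ k≡y
... | no  k≢y = inj₂ (subst (0 <_) (lookup-lcm-var-≢ k≢y) p)

∣ₘ-lcm-var⁻ : u ∣ₘ lcm (var y) v → lookup u y ≡ 0 → u ∣ₘ v
∣ₘ-lcm-var⁻ {u = u} {y} {v} u∣ uy≡0 = lookup-≤⇒∣ₘ entry
  where
  entry : ∀ k → lookup u k ≤ lookup v k
  entry k with k ≟ y
  ... | yes refl = subst (_≤ lookup v k) (sym uy≡0) z≤n
  ... | no  k≢y  = subst (lookup u k ≤_) (lookup-lcm-var-≢ k≢y) (Pointwise.lookup u∣ k)

degree-lcm-var : ∀ y (u : Monomial m) → lookup u y ≡ 0 → degree (lcm (var y) u) ≡ suc (degree u)
degree-lcm-var fzero    (_ ∷ u) refl = cong (suc ∘ degree) (lcm-identityˡ u)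
degree-lcm-var (fsuc y) (x ∷ u) uy≡0 =
  trans (cong (x +_) (degree-lcm-var y u uy≡0)) (+-suc x (degree u))

degree-lcm-var₂ : k ≢ y → lookup u k ≡ 0 → lookup u y ≡ 0 →
                  degree (lcm (var k) (lcm (var y) u)) ≡ 2 + degree u
degree-lcm-var₂ {k = k} {y} {u} k≢y uk≡0 uy≡0 =
  trans (degree-lcm-var k (lcm (var y) u) (trans (lookup-lcm-var-≢ k≢y) uk≡0))
        (cong suc (degree-lcm-var y u uy≡0))

-- closeGap g maps 0, 1, ..., g, g + 1, g + 2, ... to 0, 1, ..., g, g, g + 1, ...
closeGap : ℕ → ℕ → ℕ
closeGap zero    x       = pred x
closeGap (suc g) zero    = zero
closeGap (suc g) (suc x) = suc (closeGap g x)

closeGap-monoʳ-≤ : ∀ g {x y} → x ≤ y → closeGap g x ≤ closeGap g y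
closeGap-monoʳ-≤ zero    x≤y       = pred-mono-≤ x≤y
closeGap-monoʳ-≤ (suc g) z≤n       = z≤n
closeGap-monoʳ-≤ (suc g) (s≤s x≤y) = s≤s (closeGap-monoʳ-≤ g x≤y)

closeGap-monoʳ-< : ∀ g {x y} → x ≢ g → x < y → closeGap g x < closeGap g y
closeGap-monoʳ-< zero    {zero}          x≢g _         = ⊥-elim (x≢g refl)
closeGap-monoʳ-< zero    {suc _} {suc _} _   (s≤s x<y) = x<y
closeGap-monoʳ-< (suc g) {zero}  {suc _} _   _         = s≤s z≤n
closeGap-monoʳ-< (suc g) {suc _} {suc _} x≢g (s≤s x<y) =
  s≤s (closeGap-monoʳ-< g (x≢g ∘ cong suc) x<y)

closeGap≡suc⇒ : ∀ g {x} → closeGap g x ≡ suc g → x ≡ suc (suc g)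
closeGap≡suc⇒ zero    {suc x} eq = cong suc eq
closeGap≡suc⇒ (suc g) {suc x} eq = cong suc (closeGap≡suc⇒ g (suc-injective eq))

head-∣ₘ : ∀ {us} → Ascending (u ∷ us) → v ∈ u ∷ us → u ∣ₘ v
head-∣ₘ _            (here refl) = ∣ₘ-refl
head-∣ₘ (u<v ∷ asc) (there v∈)  = ∣ₘ-trans (proj₁ u<v) (head-∣ₘ asc v∈)

comparable : ∀ {c} → Ascending c → u ∈ c → v ∈ c → u ∣ₘ v ⊎ v ∣ₘ u
comparable asc         (here refl) v∈          = inj₁ (head-∣ₘ asc v∈)
comparable asc         (there u∈)  (here refl) = inj₂ (head-∣ₘ asc (there u∈))
comparable (_ ∷ asc)   (there u∈)  (there v∈)  = comparable asc u∈ v∈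
comparable [ _ ]       (there ())  (there _)

chain-length≤ : {P : Monomial m → Set} (rank : Monomial m → ℕ) (K : ℕ) →
  (∀ {u v} → P u → u ∣ₘ< v → rank u < rank v) → (∀ {u} → P u → rank u ≤ K) →
  ∀ {c} → All P c → Ascending c → length c ≤ suc K
chain-length≤ {P = P} rank K rank-mono rank-bound = bound
  where
  bound-from : ∀ {u us} → All P (u ∷ us) → Ascending (u ∷ us) → rank u + length us ≤ K
  bound-from {u}          (pu ∷ [])  [ _ ]       = subst (_≤ K) (sym (+-identityʳ (rank u))) (rank-bound pu)
  bound-from {u} {v ∷ us} (pu ∷ pvs) (u<v ∷ asc) = begin
    rank u + suc (length us) ≡⟨ +-suc (rank u) (length us) ⟩
    suc (rank u) + length us ≤⟨ +-monoˡ-≤ (length us) (rank-mono pu u<v) ⟩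
    rank v + length us       ≤⟨ bound-from pvs asc ⟩
    K                        ∎
    where open ≤-Reasoning

  bound : ∀ {c} → All P c → Ascending c → length c ≤ suc K
  bound []                 []  = z≤n
  bound {u ∷ _} ps@(_ ∷ _) asc = s≤s (m+n≤o⇒n≤o (rank u) (bound-from ps asc))

module _ (G : SimpleGraph) where

  edge⇒≢ : ∀ {i j} → adj G i j ≡ true → i ≢ j
  edge⇒≢ {i} h refl with () ← trans (sym h) (irrefl G i)

  crossing-edge : {P : Fin (n G) → Set} → Decidable P → ∀ {i j} → Walk G i j → P i → ¬ P j →
                  ∃[ x ] ∃[ y ] adj G x y ≡ true × P x × ¬ P y
  crossing-edge P? []                   pi ¬pj = ⊥-elim (¬pj pi)
  crossing-edge P? (_∷_ {v = k} h walk) pi ¬pj with P? k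
  ... | yes pk  = crossing-edge P? walk pk ¬pj
  ... | no  ¬pk = _ , k , h , pi , ¬pk

  complement-edge⇒non-edge : ∀ {i j} → adj (complement G) i j ≡ true → adj G i j ≡ false
  complement-edge⇒non-edge {i} {j} = not-∧ (adj G i j)
    where
    not-∧ : ∀ p {q} → not p ∧ q ≡ true → p ≡ false
    not-∧ false _ = refl

  complement-non-edge⇒edge : ∀ {i j} → i ≢ j → adj (complement G) i j ≡ false → adj G i j ≡ true
  complement-non-edge⇒edge {i} {j} i≢j rewrite dec-false (i ≟ j) i≢j = not-∧-true (adj G i j)
    where
    not-∧-true : ∀ p → not p ∧ true ≡ false → p ≡ true
    not-∧-true true _ = refl

module LcmLattice (G : SimpleGraph) where

  N : ℕ
  N = n G

  L : List (Edge G) → Monomial N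
  L S = lcmList (map (edgeMonomial G) S)

  edgeMonomial≡lcm-var : ∀ {i j} (h : adj G i j ≡ true) → edgeMonomial G (i , j , h) ≡ lcm (var i) (var j)
  edgeMonomial≡lcm-var {i} {j} _ = trans (tabulate-cong entry) (tabulate∘lookup (lcm (var i) (var j)))
    where
    indicator-∨ : ∀ p q → (if p ∨ q then 1 else 0) ≡ (if p then 1 else 0) ⊔ (if q then 1 else 0)
    indicator-∨ true  true  = refl
    indicator-∨ true  false = refl
    indicator-∨ false _     = refl

    entry : ∀ k → (if does (k ≟ i) ∨ does (k ≟ j) then 1 else 0) ≡ lookup (lcm (var i) (var j)) k
    entry k = trans (indicator-∨ (does (k ≟ i)) (does (k ≟ j)))
                    (sym (trans (lookup-lcm (var i) (var j) k) (cong₂ _⊔_ (lookup-var k i) (lookup-var k j))))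

  L-∷ : ∀ {i j} (h : adj G i j ≡ true) S → L ((i , j , h) ∷ S) ≡ lcm (var i) (lcm (var j) (L S))
  L-∷ {i} {j} h S = trans (cong (λ e → lcm e (L S)) (edgeMonomial≡lcm-var h)) (lcm-assoc (var i) (var j) (L S))

  endpoints-present : ∀ {i j} (h : adj G i j ≡ true) S →
                      0 < lookup (L ((i , j , h) ∷ S)) i × 0 < lookup (L ((i , j , h) ∷ S)) j
  endpoints-present {i} {j} h S rewrite L-∷ h S =
      var-∣ₘ⇒present (∣ₘ-lcmˡ (var i) _)
    , var-∣ₘ⇒present (∣ₘ-trans (∣ₘ-lcmˡ (var j) (L S)) (∣ₘ-lcmʳ (var i) _))

  L-squarefree : ∀ S → L S ∣ₘ replicate N 1
  L-squarefree []                = one-∣ₘ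
  L-squarefree ((i , j , h) ∷ S) rewrite L-∷ h S =
    lcm-least (var-∣ₘ-ones i) (lcm-least (var-∣ₘ-ones j) (L-squarefree S))
    where
    var-∣ₘ-ones : ∀ y → var y ∣ₘ replicate N 1
    var-∣ₘ-ones y = present⇒var-∣ₘ (subst (0 <_) (sym (lookup-replicate y 1)) (s≤s z≤n))

  degree-L≤N : ∀ S → degree (L S) ≤ N
  degree-L≤N S = subst (degree (L S) ≤_) (degree-ones N) (degree-mono (L-squarefree S))

  degree-L-single : ∀ {i j} (h : adj G i j ≡ true) → degree (L ((i , j , h) ∷ [])) ≡ 2
  degree-L-single {i} {j} h = begin
    degree (L ((i , j , h) ∷ []))           ≡⟨ cong degree (L-∷ h []) ⟩
    degree (lcm (var i) (lcm (var j) one))  ≡⟨ degree-lcm-var₂ (edge⇒≢ G h) (lookup-replicate i 0) (lookup-replicate j 0) ⟩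
    2 + degree (one {N})                    ≡⟨ cong (2 +_) (degree-one N) ⟩
    2                                       ∎
    where open ≡-Reasoning

  degree-L≢1 : ∀ S → degree (L S) ≢ 1
  degree-L≢1 []      eq = 0≢1+n (trans (sym (degree-one N)) eq)
  degree-L≢1 (e ∷ S) eq = <⇒≢ (subst (_≤ degree (L (e ∷ S))) (degree-L-single (proj₂ (proj₂ e)))
                                       (degree-mono (lcm-monoʳ (edgeMonomial G e) one-∣ₘ)))
                              (sym eq)

  degree-L-∷-pendant : ∀ {x y} (h : adj G x y ≡ true) S → 0 < lookup (L S) x → lookup (L S) y ≡ 0 →
                       degree (L ((x , y , h) ∷ S)) ≡ suc (degree (L S))
  degree-L-∷-pendant {x} {y} h S x∈ y∉ = begin
    degree (L ((x , y , h) ∷ S))               ≡⟨ cong degree (L-∷ h S) ⟩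
    degree (lcm (var x) (lcm (var y) (L S)))   ≡⟨ cong degree (lcm-absorbs {v = lcm (var y) (L S)} (present⇒var-∣ₘ x∈′)) ⟩
    degree (lcm (var y) (L S))                 ≡⟨ degree-lcm-var y (L S) y∉ ⟩
    suc (degree (L S))                         ∎
    where
    open ≡-Reasoning
    x∈′ : 0 < lookup (lcm (var y) (L S)) x
    x∈′ = present-mono (∣ₘ-lcmʳ (var y) (L S)) x∈

  neighbour-in-support : ∀ S {p} → 0 < lookup (L S) p → ∃[ q ] adj G p q ≡ true × 0 < lookup (L S) q
  neighbour-in-support [] {p} p∈ with () ← subst (0 <_) (lookup-replicate p 0) p∈
  neighbour-in-support ((i , j , h) ∷ S) {p} p∈
    with support-lcm-var {y = i} {k = p} (subst (λ u → 0 < lookup u p) (L-∷ h S) p∈)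
  ... | inj₁ refl = j , h , proj₂ (endpoints-present h S)
  ... | inj₂ p∈′ with support-lcm-var {y = j} {k = p} p∈′
  ...   | inj₁ refl = i , trans (symm G j i) h , proj₁ (endpoints-present h S)
  ...   | inj₂ p∈S =
    let q , pq , q∈ = neighbour-in-support S p∈S
    in  q , pq , present-mono (∣ₘ-lcmʳ (edgeMonomial G (i , j , h)) (L S)) q∈

  degree-≢1 : InLcmLattice G u → degree u ≢ 1
  degree-≢1 (S , refl) = degree-L≢1 S

  degree-≤N : InLcmLattice G u → degree u ≤ N
  degree-≤N (S , refl) = degree-L≤N S

  lattice-chain-length≤ : ∀ {c} → IsChain G c → length c ≤ suc (closeGap 1 N)
  lattice-chain-length≤ (all , asc) =
    chain-length≤ (closeGap 1 ∘ degree) (closeGap 1 N)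
      (λ u∈L u<v → closeGap-monoʳ-< 1 (degree-≢1 u∈L) (degree-mono-< u<v))
      (λ u∈L → closeGap-monoʳ-≤ 1 (degree-≤N u∈L))
      all asc

  module _ (connected : Connected G) where

    opaque
      ascend : ∀ S t → degree (L S) + t ≡ N → ∃[ w ] 0 < lookup (L S) w →
               ∃[ c ] IsChain G (L S ∷ c) × length c ≡ t
      ascend S zero    _         _          = [] , ((S , refl) ∷ [] , [ L S ]) , refl
      ascend S (suc t) deg+1+t≡N (w , w∈) =
        let v , v∉                   = degree<⇒absent {u = L S}
                                         (subst (degree (L S) <_) deg+1+t≡N (m<m+n (degree (L S)) (s≤s z≤n)))
            x , y , h , x∈ , y∉      = crossing-edge G (λ k → 0 <? lookup (L S) k) (proj₂ connected w v)
                                         w∈ (λ v∈ → <-irrefl (sym v∉) v∈)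
            S′                       = (x , y , h) ∷ S
            deg-S′                   = degree-L-∷-pendant h S x∈ (n≤0⇒n≡0 (≮⇒≥ y∉))
            c , (all , asc) , len≡t  = ascend S′ t
                                         (trans (cong (_+ t) deg-S′) (trans (sym (+-suc (degree (L S)) t)) deg+1+t≡N))
                                         (y , proj₂ (endpoints-present h S))
            S<S′                     = ∣ₘ∧degree<⇒∣ₘ< (∣ₘ-lcmʳ (edgeMonomial G (x , y , h)) (L S))
                                         (≤-reflexive (sym deg-S′))
        in  L S′ ∷ c , ((S , refl) ∷ all , S<S′ ∷ asc) , cong suc len≡t

module InducedC4 (G : SimpleGraph) (connected : Connected G) {a b c d : Fin (n G)}
  (a≢b : a ≢ b) (a≢d : a ≢ d) (b≢c : b ≢ c) (c≢d : c ≢ d)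
  (ab : adj G a b ≡ false) (bc : adj G b c ≡ false) (cd : adj G c d ≡ false) (da : adj G d a ≡ false)
  (ac : adj G a c ≡ true) (bd : adj G b d ≡ true) where

  open LcmLattice G

  x-ac : Monomial N
  x-ac = L ((a , c , ac) ∷ [])

  x-abcd : Monomial N
  x-abcd = L ((b , d , bd) ∷ (a , c , ac) ∷ [])

  x-abcd≡ : x-abcd ≡ lcm (var b) (lcm (var d) x-ac)
  x-abcd≡ = L-∷ bd ((a , c , ac) ∷ [])

  lookup-x-ac : ∀ {k} → k ≢ a → k ≢ c → lookup x-ac k ≡ 0
  lookup-x-ac {k} k≢a k≢c = begin
    lookup x-ac k                             ≡⟨ cong (λ u → lookup u k) (L-∷ ac []) ⟩
    lookup (lcm (var a) (lcm (var c) one)) k  ≡⟨ lookup-lcm-var-≢ k≢a ⟩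
    lookup (lcm (var c) one) k                ≡⟨ lookup-lcm-var-≢ k≢c ⟩
    lookup (one {N}) k                        ≡⟨ lookup-replicate k 0 ⟩
    0                                         ∎
    where open ≡-Reasoning

  degree-x-ac : degree x-ac ≡ 2
  degree-x-ac = degree-L-single ac

  degree-x-abcd : degree x-abcd ≡ 4
  degree-x-abcd = trans (cong degree x-abcd≡)
    (trans (degree-lcm-var₂ (edge⇒≢ G bd) (lookup-x-ac (a≢b ∘ sym) b≢c) (lookup-x-ac (a≢d ∘ sym) (c≢d ∘ sym)))
           (cong (2 +_) degree-x-ac))

  support-x-abcd : ∀ {k} → 0 < lookup x-abcd k → k ≡ b ⊎ k ≡ d ⊎ k ≡ a ⊎ k ≡ c
  support-x-abcd {k} k∈ with support-lcm-var {y = b} (subst (λ u → 0 < lookup u k) x-abcd≡ k∈)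
  ... | inj₁ k≡b = inj₁ k≡b
  ... | inj₂ k∈′ with support-lcm-var {y = d} k∈′
  ...   | inj₁ k≡d = inj₂ (inj₁ k≡d)
  ...   | inj₂ k∈ac with support-lcm-var {y = a} (subst (λ u → 0 < lookup u k) (L-∷ ac []) k∈ac)
  ...     | inj₁ k≡a = inj₂ (inj₂ (inj₁ k≡a))
  ...     | inj₂ k∈c with support-lcm-var {y = c} k∈c
  ...       | inj₁ k≡c = inj₂ (inj₂ (inj₂ k≡c))
  ...       | inj₂ k∈one with () ← subst (0 <_) (lookup-replicate k 0) k∈one

  -- The support of an element of L(I(G)) is a union of edges, and the only edges inside {a, b, c, d}
  -- are ac and bd; so with p ∈ {b, d} it also contains the other vertex q of {b, d}.
  partner : ∀ {p q u} → (∀ {k} → 0 < lookup x-abcd k → k ≡ q ⊎ k ≡ p ⊎ k ≡ a ⊎ k ≡ c) →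
            adj G p a ≡ false → adj G p c ≡ false →
            InLcmLattice G u → u ∣ₘ x-abcd → 0 < lookup u p → 0 < lookup u q
  partner {p} support pa pc (S , refl) u∣ p∈ with neighbour-in-support S p∈
  ... | r , pr , r∈ with support (present-mono u∣ r∈)
  ... | inj₁ refl                   = r∈
  ... | inj₂ (inj₁ refl)            with () ← trans (sym pr) (irrefl G p)
  ... | inj₂ (inj₂ (inj₁ refl))     with () ← trans (sym pr) pa
  ... | inj₂ (inj₂ (inj₂ refl))     with () ← trans (sym pr) pc

  d∈⇒b∈ : InLcmLattice G u → u ∣ₘ x-abcd → 0 < lookup u d → 0 < lookup u b
  d∈⇒b∈ = partner support-x-abcd da (trans (symm G d c) cd)

  b∈⇒d∈ : InLcmLattice G u → u ∣ₘ x-abcd → 0 < lookup u b → 0 < lookup u d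
  b∈⇒d∈ = partner (Sum.assocʳ ∘ Sum.map₁ Sum.swap ∘ Sum.assocˡ ∘ support-x-abcd) (trans (symm G b a) ab) bc

  x-ac∣u∣x-abcd⇒u≡ : InLcmLattice G u → x-ac ∣ₘ u → u ∣ₘ x-abcd → u ≡ x-ac ⊎ u ≡ x-abcd
  x-ac∣u∣x-abcd⇒u≡ {u = u} u∈L ac∣u u∣abcd with 0 <? lookup u b
  ... | yes b∈ = inj₂ (∣ₘ-antisym u∣abcd (subst (_∣ₘ u) (sym x-abcd≡)
                   (lcm-least (present⇒var-∣ₘ b∈) (lcm-least (present⇒var-∣ₘ (b∈⇒d∈ u∈L u∣abcd b∈)) ac∣u))))
  ... | no  b∉ = inj₁ (∣ₘ-antisym u∣ac ac∣u)
    where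
    absent : ∀ {k} → ¬ 0 < lookup u k → lookup u k ≡ 0
    absent = n≤0⇒n≡0 ∘ ≮⇒≥

    u∣ac : u ∣ₘ x-ac
    u∣ac = ∣ₘ-lcm-var⁻ (∣ₘ-lcm-var⁻ (subst (u ∣ₘ_) x-abcd≡ u∣abcd) (absent b∉))
                       (absent (b∉ ∘ d∈⇒b∈ u∈L u∣abcd))

  chain-through-x-abcd-degree≢3 : ∀ {c} → IsChain G c → x-ac ∈ c → x-abcd ∈ c → u ∈ c → degree u ≢ 3
  chain-through-x-abcd-degree≢3 (all , asc) ac∈ abcd∈ u∈ with comparable asc u∈ ac∈
  ... | inj₁ u∣ac = <⇒≢ (s≤s (subst (_ ≤_) degree-x-ac (degree-mono u∣ac)))
  ... | inj₂ ac∣u with comparable asc u∈ abcd∈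
  ...   | inj₂ abcd∣u = >⇒≢ (subst (_≤ _) degree-x-abcd (degree-mono abcd∣u))
  ...   | inj₁ u∣abcd with x-ac∣u∣x-abcd⇒u≡ (All.lookup all u∈) ac∣u u∣abcd
  ...     | inj₁ refl = <⇒≢ (s≤s (≤-reflexive degree-x-ac))
  ...     | inj₂ refl = >⇒≢ (≤-reflexive (sym degree-x-abcd))

  chain-through-x-abcd-length≤ : ∀ {c} → IsChain G c → x-ac ∈ c → x-abcd ∈ c →
                                 length c ≤ suc (closeGap 2 (closeGap 1 N))
  chain-through-x-abcd-length≤ (all , asc) ac∈ abcd∈ =
    chain-length≤ (closeGap 2 ∘ closeGap 1 ∘ degree) (closeGap 2 (closeGap 1 N))
      (λ (u∈L , u≢3) u<v → closeGap-monoʳ-< 2 (u≢3 ∘ closeGap≡suc⇒ 1)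
                             (closeGap-monoʳ-< 1 (degree-≢1 u∈L) (degree-mono-< u<v)))
      (λ (u∈L , _) → closeGap-monoʳ-≤ 2 (closeGap-monoʳ-≤ 1 (degree-≤N u∈L)))
      (All.tabulate (λ u∈ → All.lookup all u∈ , chain-through-x-abcd-degree≢3 (all , asc) ac∈ abcd∈ u∈))
      asc

  4≤N : 4 ≤ N
  4≤N = subst (_≤ N) degree-x-abcd (degree-L≤N ((b , d , bd) ∷ (a , c , ac) ∷ []))

  t : ℕ
  t = N ∸ 4

  4+t≡N : 4 + t ≡ N
  4+t≡N = m+[n∸m]≡n 4≤N

  long-tail : ∃[ c ] IsChain G (x-ac ∷ c) × length c ≡ 2 + t
  long-tail = ascend connected ((a , c , ac) ∷ []) (2 + t) (trans (cong (_+ (2 + t)) degree-x-ac) 4+t≡N)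
                     (a , proj₁ (endpoints-present ac []))

  short-tail : ∃[ c ] IsChain G (x-abcd ∷ c) × length c ≡ t
  short-tail = ascend connected ((b , d , bd) ∷ (a , c , ac) ∷ []) t (trans (cong (_+ t) degree-x-abcd) 4+t≡N)
                      (b , proj₁ (endpoints-present bd ((a , c , ac) ∷ [])))

  long : List (Monomial N)
  long = one ∷ x-ac ∷ proj₁ long-tail

  short : List (Monomial N)
  short = one ∷ x-ac ∷ x-abcd ∷ proj₁ short-tail

  one<x-ac : one ∣ₘ< x-ac
  one<x-ac = ∣ₘ∧degree<⇒∣ₘ< one-∣ₘ (subst₂ _<_ (sym (degree-one N)) (sym degree-x-ac) (s≤s z≤n))

  x-ac<x-abcd : x-ac ∣ₘ< x-abcd
  x-ac<x-abcd = ∣ₘ∧degree<⇒∣ₘ< (∣ₘ-lcmʳ (edgeMonomial G (b , d , bd)) x-ac)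
                  (subst₂ _<_ (sym degree-x-ac) (sym degree-x-abcd) (s≤s (s≤s (s≤s z≤n))))

  length-long : length long ≡ 4 + t
  length-long = cong (2 +_) (proj₂ (proj₂ long-tail))

  length-short : length short ≡ 3 + t
  length-short = cong (3 +_) (proj₂ (proj₂ short-tail))

  -- closeGap 1 (4 + t) and closeGap 2 (closeGap 1 (4 + t)) reduce to 3 + t and 2 + t, which is why
  -- the rank bounds are transported along 4 + t ≡ N.
  long-maximal : IsMaximalChain G long
  long-maximal =
      ((([] , refl) ∷ proj₁ (proj₁ (proj₂ long-tail))) , (one<x-ac ∷ proj₂ (proj₁ (proj₂ long-tail))))
    , λ c′ c′-chain _ → subst (length c′ ≤_) (sym length-long)
        (subst (λ M → length c′ ≤ suc (closeGap 1 M)) (sym 4+t≡N) (lattice-chain-length≤ c′-chain))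

  short-maximal : IsMaximalChain G short
  short-maximal =
      ( (([] , refl) ∷ ((((a , c , ac) ∷ []) , refl) ∷ proj₁ (proj₁ (proj₂ short-tail))))
      , (one<x-ac ∷ (x-ac<x-abcd ∷ proj₂ (proj₁ (proj₂ short-tail)))))
    , λ c′ c′-chain short⊆c′ → subst (length c′ ≤_) (sym length-short)
        (subst (λ M → length c′ ≤ suc (closeGap 2 (closeGap 1 M))) (sym 4+t≡N)
          (chain-through-x-abcd-length≤ c′-chain (short⊆c′ (there (here refl))) (short⊆c′ (there (there (here refl))))))

  not-pure : ¬ LcmLatticePure G
  not-pure pure = 1+n≢n (trans (sym length-long) (trans (pure long short long-maximal short-maximal) length-short))

lemma2p2 : (G : SimpleGraph) → Connected G → HasInducedC4 (complement G) → ¬ LcmLatticePure G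
lemma2p2 G connected (a , b , c , d , a≢b , a≢c , a≢d , b≢c , b≢d , c≢d , ab , bc , cd , da , ac , bd) =
  InducedC4.not-pure G connected a≢b a≢d b≢c c≢d
    (complement-edge⇒non-edge G ab) (complement-edge⇒non-edge G bc)
    (complement-edge⇒non-edge G cd) (complement-edge⇒non-edge G da)
    (complement-non-edge⇒edge G a≢c ac) (complement-non-edge⇒edge G b≢d bd)
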